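{- Let $n\ge 1$ be an integer and let $M(P_n)$ be the middle graph of the path $P_n$ on $n$ vertices. Then $$\operatorname{rn}(M(P_n))\ge\begin{cases}4k^2-1, & \text{if } n=2k,\\ 4k(k+1), & \text{if } n=2k+1.\end{cases}$$
   Context: For a graph $G$, the middle graph $M(G)$ is the graph with vertex set $V(G)\cup E(G)$ in which two vertices are adjacent if and only if either they are adjacent edges of $G$, or one is a vertex of $G$ and the other is an edge of $G$ incident to it. For a connected graph $G$ with diameter $\operatorname{diam}(G)$ and distance function $d(u,v)$, a radio labeling of $G$ is a map $\varphi:V(G)\to\{0,1,2,\dots\}$ such that $|\varphi(u)-\varphi(v)|\ge \operatorname{diam}(G)+1-d(u,v)$ for every pair of distinct vertices $u,v$. The span of $\varphi$ is $\max\{|\varphi(u)-\varphi(v)|: u,v\in V(G)\}$, and the radio number $\operatorname{rn}(G)$ is the minimum span over all radio labelings of $G$. -}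

module Defs where

open import Level using (0ℓ)
open import Data.Nat using (ℕ; zero; suc; _+_; _∸_; _≤_; ∣_-_∣)
open import Data.Fin using (Fin; inject₁) renaming (suc to fsuc)
open import Data.Product using (_×_; _,_; proj₁; proj₂; Σ; ∃)
open import Data.Sum using (_⊎_; inj₁; inj₂)
open import Data.Empty using (⊥)
open import Relation.Nullary using (¬_)
open import Relation.Binary.PropositionalEquality using (_≡_; _≢_)

record Graph : Set₁ where
  field
    Vertex : Set
    Adj    : Vertex → Vertex → Set
open Graph public

record EdgeGraph : Set₁ where
  field
    V    : Set
    E    : Set
    ends : E → V × V
open EdgeGraph public

Incident : (G : EdgeGraph) → V G → E G → Set
Incident G v e = (v ≡ proj₁ (ends G e)) ⊎ (v ≡ proj₂ (ends G e))

AdjEdges : (G : EdgeGraph) → E G → E G → Set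
AdjEdges G e f = e ≢ f × Σ (V G) λ v → Incident G v e × Incident G v f

MAdj : (G : EdgeGraph) → V G ⊎ E G → V G ⊎ E G → Set
MAdj G (inj₁ u) (inj₁ v) = ⊥
MAdj G (inj₁ u) (inj₂ f) = Incident G u f
MAdj G (inj₂ e) (inj₁ v) = Incident G v e
MAdj G (inj₂ e) (inj₂ f) = AdjEdges G e f

Middle : EdgeGraph → Graph
Middle G = record { Vertex = V G ⊎ E G ; Adj = MAdj G }

pathEnds : (n : ℕ) → Fin (n ∸ 1) → Fin n × Fin n
pathEnds zero    ()
pathEnds (suc m) i = inject₁ i , fsuc i

Path : ℕ → EdgeGraph
Path n = record { V = Fin n ; E = Fin (n ∸ 1) ; ends = pathEnds n }

data Walk (G : Graph) : Vertex G → Vertex G → ℕ → Set where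
  here : ∀ {u} → Walk G u u 0
  step : ∀ {u v w k} → Adj G u v → Walk G v w k → Walk G u w (suc k)

Dist : (G : Graph) → Vertex G → Vertex G → ℕ → Set
Dist G u v d = Walk G u v d × (∀ k → Walk G u v k → d ≤ k)

IsDiameter : (G : Graph) → ℕ → Set
IsDiameter G D =
  (∀ u v → Σ ℕ λ d → Dist G u v d × d ≤ D)
  × Σ (Vertex G) λ u → Σ (Vertex G) λ v → Dist G u v D

IsRadioLabeling : (G : Graph) → ℕ → (Vertex G → ℕ) → Set
IsRadioLabeling G D φ =
  ∀ u v → u ≢ v → ∀ d → Dist G u v d → (D + 1) ∸ d ≤ ∣ φ u - φ v ∣

SpanAtLeast : (G : Graph) → (Vertex G → ℕ) → ℕ → Set
SpanAtLeast G φ L = Σ (Vertex G) λ u → Σ (Vertex G) λ v → L ≤ ∣ φ u - φ v ∣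

RadioNumberAtLeast : Graph → ℕ → Set
RadioNumberAtLeast G L =
  ∀ D → IsDiameter G D → ∀ φ → IsRadioLabeling G D φ → SpanAtLeast G φ L

-- Lay the vertices of M(P_{m+1}) on a line: vertex i of the path at position 2i and
-- the edge {i, i+1} at 2i+1. Twice the distance between x and y is then |pos x - pos y|
-- plus one for each of x, y that is a vertex of the path, so it is at most L x + L y
-- for L x = |pos x - m| + [x is a vertex of the path]. List the 2m+1 vertices in
-- increasing order of a radio labeling f: each consecutive pair satisfies
-- 2 (f y - f x) >= 2 (diam + 1) - L x - L y. Summing the 2m gaps, with diam >= m + 1,
-- sum L = (m+1)^2 and L vanishing at most once, gives span >= m^2 + 2m; this is
-- 4k^2 - 1 for n = 2k and 4k(k+1) for n = 2k+1.

module Submission where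

open import Defs
open import Data.Nat using (ℕ; zero; suc; _+_; _*_; _∸_; _≤_; _<_; ∣_-_∣; z≤n; s≤s; s≤s⁻¹; z<s)
open import Data.Nat.Properties
open import Data.Nat.ListAction using (sum)
open import Data.Nat.ListAction.Properties using (sum-++; sum-↭)
open import Data.Nat.Tactic.RingSolver using (solve-∀)
open import Data.Fin using (Fin; toℕ; lower₁; fromℕ) renaming (zero to fzero; suc to fsuc)
open import Data.Fin.Properties
  using (toℕ-injective; toℕ-inject₁; toℕ-lower₁; inject₁-lower₁; toℕ<n; toℕ≤pred[n]; toℕ-fromℕ)
open import Data.List using (List; []; _∷_; _∷ʳ_; _++_; length; map; upTo)
open import Data.List.Properties using (length-map; length-upTo; map-++; map-applyUpTo; applyUpTo-∷ʳ; map-∘; map-cong)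
open import Data.List.Relation.Unary.All using (All; _∷_)
open import Data.List.Relation.Unary.AllPairs using (_∷_; head)
open import Data.List.Relation.Unary.Linked using (Linked; _∷_)
open import Data.List.Relation.Unary.Unique.Propositional using (Unique)
open import Data.List.Relation.Unary.Unique.Propositional.Properties using (map⁻; upTo⁺)
open import Data.List.Relation.Binary.Permutation.Propositional using (↭-sym; ↭⇒↭ₛ)
open import Data.List.Relation.Binary.Permutation.Propositional.Properties using (↭-length; map⁺)
open import Data.List.Relation.Binary.Permutation.Setoid.Properties using (Unique-resp-↭)
import Data.List.Sort as Sort
open import Data.Sum using (inj₁; inj₂)
import Data.Sum as Sum
open import Data.Product using (_×_; _,_; proj₁; proj₂; Σ)
open import Data.Empty using (⊥-elim)
open import Function using (_∘_; id)
open import Relation.Binary.PropositionalEquality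
open import Relation.Binary.PropositionalEquality.Properties using (setoid)
import Relation.Binary.Construct.On as On

reverse : {G : Graph} → (∀ {u v} → Adj G u v → Adj G v u) →
          ∀ {u v k} → Walk G u v k → Walk G v u k
reverse sym-adj here = here
reverse sym-adj (step a w) = snoc (reverse sym-adj w) (sym-adj a)
  where
  snoc : ∀ {G u v w k} → Walk G u v k → Adj G v w → Walk G u w (suc k)
  snoc here b = step b here
  snoc (step a w) b = step a (snoc w b)

middle-adj-sym : ∀ {G : EdgeGraph} {x y} → MAdj G x y → MAdj G y x
middle-adj-sym {x = inj₁ _} {inj₂ _} a = a
middle-adj-sym {x = inj₂ _} {inj₁ _} a = a
middle-adj-sym {x = inj₂ _} {inj₂ _} (e≢f , v , ve , vf) = ≢-sym e≢f , v , vf , ve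

lastOf : {A : Set} → A → List A → A
lastOf y [] = y
lastOf y (z ∷ zs) = lastOf z zs

lastOf-All : {A : Set} {P : A → Set} → ∀ y ys → All P (y ∷ ys) → P (lastOf y ys)
lastOf-All y [] (p ∷ _) = p
lastOf-All y (z ∷ zs) (_ ∷ ps) = lastOf-All z zs ps

module _ {A : Set} (φ H : A → ℕ) (c : ℕ)
         (gap : ∀ u v → u ≢ v → φ u ≤ φ v → c + 2 * φ u ≤ 2 * φ v + (H u + H v)) where

  open Sort (On.decTotalOrder ≤-decTotalOrder φ) using (sort; sort-↗; sort-↭)

  telescope : ∀ y ys → Linked (λ a b → φ a ≤ φ b) (y ∷ ys) → Unique (y ∷ ys) →
              length ys * c + (H y + H (lastOf y ys)) + 2 * φ y
                ≤ 2 * φ (lastOf y ys) + 2 * sum (map H (y ∷ ys))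
  telescope y [] _ _ = ≤-reflexive (base (H y) (φ y))
    where
    base : ∀ h f → 0 + (h + h) + 2 * f ≡ 2 * f + 2 * (h + 0)
    base = solve-∀
  telescope y (z ∷ zs) (y≤z ∷ sorted) ((y≢z ∷ _) ∷ distinct) =
    +-cancelˡ-≤ (H z + 2 * φ z) _ _ (begin
      (H z + 2 * φ z) + (suc (length zs) * c + (H y + H l) + 2 * φ y)
        ≡⟨ regroupˡ (length zs * c) c (H y) (H z) (H l) (φ y) (φ z) ⟩
      (length zs * c + (H z + H l) + 2 * φ z) + (c + 2 * φ y) + H y
        ≤⟨ +-monoˡ-≤ (H y) (+-mono-≤ (telescope z zs sorted distinct) (gap y z y≢z y≤z)) ⟩
      (2 * φ l + 2 * sum (map H (z ∷ zs))) + (2 * φ z + (H y + H z)) + H y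
        ≡⟨ regroupʳ (φ l) (sum (map H zs)) (H y) (H z) (φ z) ⟩
      (H z + 2 * φ z) + (2 * φ l + 2 * sum (map H (y ∷ z ∷ zs))) ∎)
    where
    open ≤-Reasoning
    l : A
    l = lastOf z zs
    regroupˡ : ∀ nc c hy hz hl fy fz →
      (hz + 2 * fz) + ((c + nc) + (hy + hl) + 2 * fy) ≡ (nc + (hz + hl) + 2 * fz) + (c + 2 * fy) + hy
    regroupˡ = solve-∀
    regroupʳ : ∀ fl s hy hz fz →
      (2 * fl + 2 * (hz + s)) + (2 * fz + (hy + hz)) + hy ≡ (hz + 2 * fz) + (2 * fl + 2 * (hy + (hz + s)))
    regroupʳ = solve-∀

  enumeration-telescope : ∀ {n} (xs : List A) → Unique xs → length xs ≡ suc n → 0 < n →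
             Σ A λ u → Σ A λ v → u ≢ v × n * c + (H u + H v) + 2 * φ u ≤ 2 * φ v + 2 * sum (map H xs)
  enumeration-telescope xs distinct len n>0
    with sort xs | sort-↗ xs | sort-↭ xs
  ... | [] | _ | xs↭ = ⊥-elim (0≢1+n (trans (↭-length xs↭) len))
  ... | y ∷ [] | _ | xs↭ = ⊥-elim (<⇒≢ n>0 (suc-injective (trans (↭-length xs↭) len)))
  ... | y ∷ z ∷ zs | sorted | xs↭ =
    y , lastOf z zs , lastOf-All z zs y≢ys ,
    subst₂ (λ k s → k * c + (H y + H (lastOf z zs)) + 2 * φ y ≤ 2 * φ (lastOf z zs) + 2 * s)
           tail-length (sum-↭ (map⁺ H xs↭))
           (telescope y (z ∷ zs) sorted sorted-distinct)
    where
    tail-length : length (z ∷ zs) ≡ _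
    tail-length = suc-injective (trans (↭-length xs↭) len)
    sorted-distinct : Unique (y ∷ z ∷ zs)
    sorted-distinct = Unique-resp-↭ (setoid A) (↭⇒↭ₛ (↭-sym xs↭)) distinct
    y≢ys : All (y ≢_) (z ∷ zs)
    y≢ys = head sorted-distinct

radio-gap : {G : Graph} {D : ℕ} {φ : Vertex G → ℕ} → IsRadioLabeling G D φ →
            (∀ u v → Σ ℕ (Dist G u v)) →
            (H : Vertex G → ℕ) → (∀ u v → Σ ℕ λ w → Walk G u v w × 2 * w ≤ H u + H v) →
            ∀ u v → u ≢ v → φ u ≤ φ v → 2 * (D + 1) + 2 * φ u ≤ 2 * φ v + (H u + H v)
radio-gap {D = D} {φ} radio distance H short u v u≢v φu≤φv = begin
  2 * (D + 1) + 2 * φ u  ≡⟨ *-distribˡ-+ 2 (D + 1) (φ u) ⟨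
  2 * (D + 1 + φ u)      ≤⟨ *-monoʳ-≤ 2 separation ⟩
  2 * (d + φ v)          ≡⟨ *-distribˡ-+ 2 d (φ v) ⟩
  2 * d + 2 * φ v        ≤⟨ +-monoˡ-≤ (2 * φ v) (≤-trans (*-monoʳ-≤ 2 d≤w) 2w≤H) ⟩
  H u + H v + 2 * φ v    ≡⟨ +-comm (H u + H v) (2 * φ v) ⟩
  2 * φ v + (H u + H v)  ∎
  where
  open ≤-Reasoning
  d w : ℕ
  d = proj₁ (distance u v)
  w = proj₁ (short u v)
  d≤w : d ≤ w
  d≤w = proj₂ (proj₂ (distance u v)) w (proj₁ (proj₂ (short u v)))
  2w≤H : 2 * w ≤ H u + H v
  2w≤H = proj₂ (proj₂ (short u v))
  label-gap : (D + 1) ∸ d ≤ φ v ∸ φ u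
  label-gap = subst ((D + 1) ∸ d ≤_) (m≤n⇒∣m-n∣≡n∸m φu≤φv) (radio u v u≢v d (proj₂ (distance u v)))
  separation : D + 1 + φ u ≤ d + φ v
  separation = begin
    D + 1 + φ u              ≤⟨ +-monoˡ-≤ (φ u) (m≤n+m∸n (D + 1) d) ⟩
    d + ((D + 1) ∸ d) + φ u  ≤⟨ +-monoˡ-≤ (φ u) (+-monoʳ-≤ d label-gap) ⟩
    d + (φ v ∸ φ u) + φ u    ≡⟨ +-assoc d (φ v ∸ φ u) (φ u) ⟩
    d + (φ v ∸ φ u + φ u)    ≡⟨ cong (d +_) (m∸n+n≡m φu≤φv) ⟩
    d + φ v                  ∎

sum-map-+ : {A : Set} (f g : A → ℕ) (xs : List A) →
            sum (map (λ x → f x + g x) xs) ≡ sum (map f xs) + sum (map g xs)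
sum-map-+ f g [] = refl
sum-map-+ f g (x ∷ xs) = trans (cong (f x + g x +_) (sum-map-+ f g xs)) (interchange (f x) (g x) _ _)
  where
  interchange : ∀ a b c d → a + b + (c + d) ≡ a + c + (b + d)
  interchange = solve-∀

sum-upTo-∷ʳ : ∀ (f : ℕ → ℕ) n → sum (map f (upTo (suc n))) ≡ sum (map f (upTo n)) + f n
sum-upTo-∷ʳ f n = begin
  sum (map f (upTo (suc n)))          ≡⟨ cong (sum ∘ map f) (applyUpTo-∷ʳ id n) ⟨
  sum (map f (upTo n ∷ʳ n))           ≡⟨ cong sum (map-++ f (upTo n) (n ∷ [])) ⟩
  sum (map f (upTo n) ++ f n ∷ [])    ≡⟨ sum-++ (map f (upTo n)) (f n ∷ []) ⟩
  sum (map f (upTo n)) + (f n + 0)    ≡⟨ cong (sum (map f (upTo n)) +_) (+-identityʳ (f n)) ⟩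
  sum (map f (upTo n)) + f n          ∎
  where open ≡-Reasoning

sum-upTo-suc : ∀ (f : ℕ → ℕ) n → sum (map f (upTo (suc n))) ≡ f 0 + sum (map (f ∘ suc) (upTo n))
sum-upTo-suc f n =
  cong (λ xs → f 0 + sum xs) (trans (map-applyUpTo suc f n) (sym (map-applyUpTo id (f ∘ suc) n)))

sum-∣-centre∣ : ∀ c → sum (map (λ p → ∣ p - c ∣) (upTo (suc (2 * c)))) ≡ c * suc c
sum-∣-centre∣ zero = refl
sum-∣-centre∣ (suc c) = begin
  sum (map f (upTo (suc (2 * suc c))))
    ≡⟨ cong (sum ∘ map f ∘ upTo ∘ suc) (*-suc 2 c) ⟩
  sum (map f (upTo (suc (suc (suc (2 * c))))))
    ≡⟨ sum-upTo-∷ʳ f (suc (suc (2 * c))) ⟩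
  sum (map f (upTo (suc (suc (2 * c))))) + f (suc (suc (2 * c)))
    ≡⟨ cong (_+ f (suc (suc (2 * c)))) (sum-upTo-suc f (suc (2 * c))) ⟩
  suc c + sum (map (λ p → ∣ p - c ∣) (upTo (suc (2 * c)))) + ∣ suc (2 * c) - c ∣
    ≡⟨ cong₂ (λ a b → suc c + a + b) (sum-∣-centre∣ c) far-end ⟩
  suc c + c * suc c + suc c
    ≡⟨ close c ⟩
  suc c * suc (suc c) ∎
  where
  open ≡-Reasoning
  f : ℕ → ℕ
  f p = ∣ p - suc c ∣
  far-end : ∣ suc (2 * c) - c ∣ ≡ suc c
  far-end = trans (cong ∣_- c ∣ (odd-split c)) (trans (∣-∣-comm (c + suc c) c) (∣m-m+n∣≡n c (suc c)))
    where
    odd-split : ∀ c → suc (2 * c) ≡ c + suc c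
    odd-split = solve-∀
  close : ∀ c → suc c + c * suc c + suc c ≡ suc c * suc (suc c)
  close = solve-∀

half-≤ : ∀ {a b} → 2 * a ≤ suc (2 * b) → a ≤ b
half-≤ {a} {b} 2a≤ = *-cancelˡ-≤ 2 (s≤s⁻¹ (≤∧≢⇒< 2a≤ (even≢odd a b)))

-- Indexed by the number m of edges of the path, i.e. M(P_{m+1}).
MP : ℕ → Graph
MP m = Middle (Path (suc m))

pos : ∀ {m} → Vertex (MP m) → ℕ
pos (inj₁ i) = 2 * toℕ i
pos (inj₂ e) = suc (2 * toℕ e)

isVertex : ∀ {m} → Vertex (MP m) → ℕ
isVertex (inj₁ _) = 1
isVertex (inj₂ _) = 0

dist₂ : ∀ {m} → Vertex (MP m) → Vertex (MP m) → ℕ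
dist₂ x y = ∣ pos x - pos y ∣ + isVertex x + isVertex y

pos-injective : ∀ {m} {x y : Vertex (MP m)} → pos x ≡ pos y → x ≡ y
pos-injective {x = inj₁ i} {inj₁ j} eq = cong inj₁ (toℕ-injective (*-cancelˡ-≡ (toℕ i) (toℕ j) 2 eq))
pos-injective {x = inj₁ i} {inj₂ f} eq = ⊥-elim (even≢odd (toℕ i) (toℕ f) eq)
pos-injective {x = inj₂ e} {inj₁ j} eq = ⊥-elim (even≢odd (toℕ j) (toℕ e) (sym eq))
pos-injective {x = inj₂ e} {inj₂ f} eq = cong inj₂ (toℕ-injective (*-cancelˡ-≡ (toℕ e) (toℕ f) 2 (suc-injective eq)))

pos-bound : ∀ {m} (x : Vertex (MP m)) → pos x ≤ 2 * m
pos-bound (inj₁ i) = *-monoʳ-≤ 2 (toℕ≤pred[n] i)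
pos-bound (inj₂ e) = *-monoʳ-< 2 (toℕ<n e)

dist₂-sym : ∀ {m} (x y : Vertex (MP m)) → dist₂ x y ≡ dist₂ y x
dist₂-sym x y = begin
  ∣ pos x - pos y ∣ + isVertex x + isVertex y  ≡⟨ cong (λ a → a + isVertex x + isVertex y) (∣-∣-comm (pos x) (pos y)) ⟩
  ∣ pos y - pos x ∣ + isVertex x + isVertex y  ≡⟨ +-assoc _ (isVertex x) (isVertex y) ⟩
  ∣ pos y - pos x ∣ + (isVertex x + isVertex y) ≡⟨ cong (∣ pos y - pos x ∣ +_) (+-comm (isVertex x) (isVertex y)) ⟩
  ∣ pos y - pos x ∣ + (isVertex y + isVertex x) ≡⟨ +-assoc _ (isVertex y) (isVertex x) ⟨
  ∣ pos y - pos x ∣ + isVertex y + isVertex x  ∎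
  where open ≡-Reasoning

dist₂-triangle : ∀ {m} (x y z : Vertex (MP m)) → dist₂ x z ≤ dist₂ x y + dist₂ y z
dist₂-triangle x y z = begin
  ∣ pos x - pos z ∣ + isVertex x + isVertex z
    ≤⟨ +-monoˡ-≤ (isVertex z) (+-monoˡ-≤ (isVertex x) (∣-∣-triangle (pos x) (pos y) (pos z))) ⟩
  ∣ pos x - pos y ∣ + ∣ pos y - pos z ∣ + isVertex x + isVertex z
    ≤⟨ m≤m+n _ (2 * isVertex y) ⟩
  ∣ pos x - pos y ∣ + ∣ pos y - pos z ∣ + isVertex x + isVertex z + 2 * isVertex y
    ≡⟨ regroup ∣ pos x - pos y ∣ ∣ pos y - pos z ∣ (isVertex x) (isVertex y) (isVertex z) ⟩
  dist₂ x y + dist₂ y z ∎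
  where
  open ≤-Reasoning
  regroup : ∀ a b bx by bz → a + b + bx + bz + 2 * by ≡ a + bx + by + (b + by + bz)
  regroup = solve-∀

∣n-1+n∣≡1 : ∀ n → ∣ n - suc n ∣ ≡ 1
∣n-1+n∣≡1 zero = refl
∣n-1+n∣≡1 (suc n) = ∣n-1+n∣≡1 n

incident-gap : ∀ {m} {v : Fin (suc m)} {e : Fin m} → Incident (Path (suc m)) v e →
               ∣ pos {m} (inj₁ v) - pos {m} (inj₂ e) ∣ ≡ 1
incident-gap {e = e} (inj₁ refl) rewrite toℕ-inject₁ e = ∣n-1+n∣≡1 (2 * toℕ e)
incident-gap {e = e} (inj₂ refl) = begin
  ∣ 2 * suc a - suc (2 * a) ∣      ≡⟨ cong ∣_- suc (2 * a) ∣ (*-suc 2 a) ⟩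
  ∣ suc (suc (2 * a)) - suc (2 * a) ∣ ≡⟨ ∣-∣-comm (suc (2 * a)) (2 * a) ⟩
  ∣ 2 * a - suc (2 * a) ∣          ≡⟨ ∣n-1+n∣≡1 (2 * a) ⟩
  1                                ∎
  where
  open ≡-Reasoning
  a = toℕ e

adjacent-dist₂ : ∀ {m} {x y : Vertex (MP m)} → Adj (MP m) x y → dist₂ x y ≤ 2
adjacent-dist₂ {x = inj₁ v} {inj₂ e} v∈e rewrite incident-gap v∈e = ≤-refl
adjacent-dist₂ {x = inj₂ e} {inj₁ v} v∈e
  rewrite ∣-∣-comm (pos (inj₂ e)) (pos (inj₁ v)) | incident-gap v∈e = ≤-refl
adjacent-dist₂ {m} {x = inj₂ e} {inj₂ f} (_ , v , v∈e , v∈f) = begin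
  ∣ pos x - pos y ∣ + 0 + 0         ≡⟨ +-identityʳ _ ⟩
  ∣ pos x - pos y ∣ + 0             ≡⟨ +-identityʳ _ ⟩
  ∣ pos x - pos y ∣                 ≤⟨ ∣-∣-triangle (pos x) (pos {m} (inj₁ v)) (pos y) ⟩
  ∣ pos x - pos {m} (inj₁ v) ∣ + ∣ pos {m} (inj₁ v) - pos y ∣
    ≡⟨ cong₂ _+_ (trans (∣-∣-comm (pos x) (pos {m} (inj₁ v))) (incident-gap v∈e)) (incident-gap v∈f) ⟩
  2                                 ∎
  where
  open ≤-Reasoning
  x y : Vertex (MP m)
  x = inj₂ e
  y = inj₂ f

walk-dist₂ : ∀ {m} {x y : Vertex (MP m)} {k} → Walk (MP m) x y (suc k) → dist₂ x y ≤ 2 * suc k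
walk-dist₂ (step a here) = adjacent-dist₂ a
walk-dist₂ {x = x} {y} (step {v = z} {k = suc k} a w) = begin
  dist₂ x y              ≤⟨ dist₂-triangle x z y ⟩
  dist₂ x z + dist₂ z y  ≤⟨ +-mono-≤ (adjacent-dist₂ a) (walk-dist₂ w) ⟩
  2 + 2 * suc k          ≡⟨ *-suc 2 (suc k) ⟨
  2 * suc (suc k)        ∎
  where open ≤-Reasoning

room : ∀ {m} (x y : Vertex (MP m)) {d} → pos x + d ≡ pos y → pos x + d ≤ 2 * m
room {m} x y eq = subst (_≤ 2 * m) (sym eq) (pos-bound y)

advance : ∀ {p q r d} k → q ≡ k + p → p + (k + d) ≡ r → q + d ≡ r
advance {p} {d = d} k refl eq = trans (trans (cong (_+ d) (+-comm k p)) (+-assoc p k d)) eq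

step-bound : ∀ w {t} → 2 * w ≤ t → 2 * suc w ≤ 2 + t
step-bound w {t} 2w≤t = subst (_≤ 2 + t) (sym (*-suc 2 w)) (+-monoʳ-≤ 2 2w≤t)

-- From an edge vertex the walk moves to the next edge (two positions at once), never
-- through a path vertex; this is what makes it as short as dist₂ predicts.
walk-rightward : ∀ {m} d (x y : Vertex (MP m)) → pos x + d ≡ pos y →
                 Σ ℕ λ w → Walk (MP m) x y w × 2 * w ≤ d + isVertex x + isVertex y
walk-rightward zero x y eq with pos-injective {x = x} {y} (trans (sym (+-identityʳ (pos x))) eq)
... | refl = 0 , here , z≤n
walk-rightward {m} (suc d) (inj₁ i) y eq =
  let w , W , 2w≤ = walk-rightward d (inj₂ e) y
                      (advance 1 (cong suc (cong (2 *_) (toℕ-lower₁ i m≢i))) eq)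
  in suc w , step (inj₁ (sym (inject₁-lower₁ i m≢i))) W ,
     subst (2 * suc w ≤_) (regroup d (isVertex y)) (step-bound w 2w≤)
  where
  m≢i : m ≢ toℕ i
  m≢i = >⇒≢ (*-cancelˡ-< 2 (toℕ i) m (<-≤-trans (m<m+n (2 * toℕ i) z<s) (room (inj₁ i) y eq)))
  e : Fin m
  e = lower₁ i m≢i
  regroup : ∀ d b → 2 + (d + 0 + b) ≡ suc d + 1 + b
  regroup = solve-∀
walk-rightward {m} (suc zero) (inj₂ e) y eq
  with pos-injective {x = inj₁ (fsuc e)} {y} (trans (*-suc 2 (toℕ e)) (trans (sym (+-comm _ 1)) eq))
... | refl = 1 , step (inj₂ refl) here , ≤-refl
walk-rightward {m} (suc (suc d)) (inj₂ e) y eq =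
  let w , W , 2w≤ = walk-rightward d (inj₂ f) y
                      (advance 2 (cong suc (trans (cong (2 *_) (toℕ-lower₁ (fsuc e) m≢1+e)) (*-suc 2 (toℕ e)))) eq)
  in suc w , step adjacent W , step-bound w 2w≤
  where
  next-edge-pos : ∀ a → suc (2 * suc a) ≡ suc (2 * a) + 2
  next-edge-pos = solve-∀
  2+2e<2m : 2 * suc (toℕ e) < 2 * m
  2+2e<2m = begin
    suc (2 * suc (toℕ e))          ≡⟨ next-edge-pos (toℕ e) ⟩
    suc (2 * toℕ e) + 2            ≤⟨ +-monoʳ-≤ (suc (2 * toℕ e)) (s≤s (s≤s z≤n)) ⟩
    suc (2 * toℕ e) + suc (suc d)  ≤⟨ room (inj₂ e) y eq ⟩
    2 * m                          ∎
    where open ≤-Reasoning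
  m≢1+e : m ≢ suc (toℕ e)
  m≢1+e = >⇒≢ (*-cancelˡ-< 2 (suc (toℕ e)) m 2+2e<2m)
  f : Fin m
  f = lower₁ (fsuc e) m≢1+e
  adjacent : Adj (MP m) (inj₂ e) (inj₂ f)
  adjacent = (λ e≡f → 1+n≢n (trans (sym (toℕ-lower₁ (fsuc e) m≢1+e)) (cong toℕ (sym e≡f))))
           , fsuc e , inj₂ refl , inj₁ (sym (inject₁-lower₁ (fsuc e) m≢1+e))

walk-from-left : ∀ {m} (x y : Vertex (MP m)) → pos x ≤ pos y →
                 Σ ℕ λ w → Walk (MP m) x y w × 2 * w ≤ dist₂ x y
walk-from-left x y px≤py =
  let w , W , 2w≤ = walk-rightward (pos y ∸ pos x) x y (m+[n∸m]≡n px≤py)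
  in w , W , subst (λ a → 2 * w ≤ a + isVertex x + isVertex y) (sym (m≤n⇒∣m-n∣≡n∸m px≤py)) 2w≤

short-walk : ∀ {m} (x y : Vertex (MP m)) → Σ ℕ λ w → Walk (MP m) x y w × 2 * w ≤ dist₂ x y
short-walk x y with ≤-total (pos x) (pos y)
... | inj₁ px≤py = walk-from-left x y px≤py
... | inj₂ py≤px =
  let w , W , 2w≤ = walk-from-left y x py≤px
  in w , reverse middle-adj-sym W , subst (2 * w ≤_) (dist₂-sym y x) 2w≤

level : ∀ {m} → Vertex (MP m) → ℕ
level {m} x = ∣ pos x - m ∣ + isVertex x

dist₂≤level+level : ∀ {m} (x y : Vertex (MP m)) → dist₂ x y ≤ level x + level y
dist₂≤level+level {m} x y = begin
  ∣ pos x - pos y ∣ + isVertex x + isVertex y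
    ≤⟨ +-monoˡ-≤ (isVertex y) (+-monoˡ-≤ (isVertex x) (∣-∣-triangle (pos x) m (pos y))) ⟩
  ∣ pos x - m ∣ + ∣ m - pos y ∣ + isVertex x + isVertex y
    ≡⟨ cong (λ a → ∣ pos x - m ∣ + a + isVertex x + isVertex y) (∣-∣-comm m (pos y)) ⟩
  ∣ pos x - m ∣ + ∣ pos y - m ∣ + isVertex x + isVertex y
    ≡⟨ regroup ∣ pos x - m ∣ ∣ pos y - m ∣ (isVertex x) (isVertex y) ⟩
  level x + level y ∎
  where
  open ≤-Reasoning
  regroup : ∀ a b c d → a + b + c + d ≡ a + c + (b + d)
  regroup = solve-∀

level+level-positive : ∀ {m} (x y : Vertex (MP m)) → x ≢ y → 0 < level x + level y
level+level-positive {m} x y x≢y = n≢0⇒n>0 λ sum≡0 →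
  x≢y (pos-injective (trans (centre x (m+n≡0⇒m≡0 (level x) sum≡0)) (sym (centre y (m+n≡0⇒n≡0 (level x) sum≡0)))))
  where
  centre : ∀ z → level z ≡ 0 → pos z ≡ m
  centre z level≡0 = ∣m-n∣≡0⇒m≡n (m+n≡0⇒m≡0 ∣ pos z - m ∣ level≡0)

shift : ∀ {m} → Vertex (MP m) → Vertex (MP (suc m))
shift = Sum.map fsuc fsuc

pos-shift : ∀ {m} (x : Vertex (MP m)) → pos (shift x) ≡ 2 + pos x
pos-shift (inj₁ i) = *-suc 2 (toℕ i)
pos-shift (inj₂ e) = cong suc (*-suc 2 (toℕ e))

isVertex-shift : ∀ {m} (x : Vertex (MP m)) → isVertex (shift x) ≡ isVertex x
isVertex-shift (inj₁ _) = refl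
isVertex-shift (inj₂ _) = refl

order : ∀ m → List (Vertex (MP m))
order zero = inj₁ fzero ∷ []
order (suc m) = inj₁ fzero ∷ inj₂ fzero ∷ map shift (order m)

map-pos-order : ∀ m → map pos (order m) ≡ upTo (suc (2 * m))
map-pos-order zero = refl
map-pos-order (suc m) = begin
  0 ∷ 1 ∷ map pos (map shift (order m))     ≡⟨ cong (λ ps → 0 ∷ 1 ∷ ps) (map-∘ (order m)) ⟨
  0 ∷ 1 ∷ map (pos ∘ shift) (order m)       ≡⟨ cong (λ ps → 0 ∷ 1 ∷ ps) (map-cong pos-shift (order m)) ⟩
  0 ∷ 1 ∷ map ((2 +_) ∘ pos) (order m)      ≡⟨ cong (λ ps → 0 ∷ 1 ∷ ps) (map-∘ (order m)) ⟩
  0 ∷ 1 ∷ map (2 +_) (map pos (order m))    ≡⟨ cong (λ ps → 0 ∷ 1 ∷ map (2 +_) ps) (map-pos-order m) ⟩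
  0 ∷ 1 ∷ map (2 +_) (upTo (suc (2 * m)))   ≡⟨ cong (λ ps → 0 ∷ 1 ∷ ps) (map-applyUpTo id (2 +_) (suc (2 * m))) ⟩
  upTo (suc (2 + 2 * m))                    ≡⟨ cong (upTo ∘ suc) (*-suc 2 m) ⟨
  upTo (suc (2 * suc m))                    ∎
  where open ≡-Reasoning

order-unique : ∀ m → Unique (order m)
order-unique m = map⁻ (subst Unique (sym (map-pos-order m)) (upTo⁺ (suc (2 * m))))

order-length : ∀ m → length (order m) ≡ suc (2 * m)
order-length m = trans (sym (length-map pos (order m))) (trans (cong length (map-pos-order m)) (length-upTo _))

sum-isVertex-order : ∀ m → sum (map isVertex (order m)) ≡ suc m
sum-isVertex-order zero = refl
sum-isVertex-order (suc m) = cong suc (begin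
  sum (map isVertex (map shift (order m)))  ≡⟨ cong sum (map-∘ (order m)) ⟨
  sum (map (isVertex ∘ shift) (order m))    ≡⟨ cong sum (map-cong isVertex-shift (order m)) ⟩
  sum (map isVertex (order m))              ≡⟨ sum-isVertex-order m ⟩
  suc m                                     ∎)
  where open ≡-Reasoning

sum-level-order : ∀ m → sum (map level (order m)) ≡ m * suc m + suc m
sum-level-order m = begin
  sum (map level (order m))
    ≡⟨ sum-map-+ (λ x → ∣ pos x - m ∣) isVertex (order m) ⟩
  sum (map (λ x → ∣ pos x - m ∣) (order m)) + sum (map isVertex (order m))
    ≡⟨ cong (_+ sum (map isVertex (order m))) (cong sum (map-∘ {g = ∣_- m ∣} {f = pos} (order m))) ⟩
  sum (map ∣_- m ∣ (map pos (order m))) + sum (map isVertex (order m))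
    ≡⟨ cong₂ (λ ps s → sum (map ∣_- m ∣ ps) + s) (map-pos-order m) (sum-isVertex-order m) ⟩
  sum (map ∣_- m ∣ (upTo (suc (2 * m)))) + suc m
    ≡⟨ cong (_+ suc m) (sum-∣-centre∣ m) ⟩
  m * suc m + suc m ∎
  where open ≡-Reasoning

endpoints-far : ∀ m {k} → Walk (MP (suc m)) (inj₁ fzero) (inj₁ (fromℕ (suc m))) k → suc (suc m) ≤ k
endpoints-far m {suc k} W = *-cancelˡ-≤ 2 (subst (_≤ 2 * suc k) endpoints-dist₂ (walk-dist₂ W))
  where
  endpoints-dist₂ : 2 * toℕ (fromℕ (suc m)) + 1 + 1 ≡ 2 * suc (suc m)
  endpoints-dist₂ = trans (cong (λ n → 2 * n + 1 + 1) (toℕ-fromℕ (suc m))) (double-suc (suc m))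
    where
    double-suc : ∀ n → 2 * n + 1 + 1 ≡ 2 * suc n
    double-suc = solve-∀

span-arithmetic : ∀ m D {a b h} → suc m ≤ D → 0 < h →
                  2 * m * (2 * (D + 1)) + h + 2 * a ≤ 2 * b + 2 * (m * suc m + suc m) →
                  m * m + 2 * m ≤ ∣ b - a ∣
span-arithmetic m D {a} {b} {h} m<D h>0 chain =
  ≤-trans (m+n≤o⇒m≤o∸n (m * m + 2 * m) (half-≤ doubled)) (m∸n≤∣m-n∣ b a)
  where
  open ≤-Reasoning
  S : ℕ
  S = m * suc m + suc m
  doubled : 2 * (m * m + 2 * m + a) ≤ suc (2 * b)
  doubled = +-cancelʳ-≤ (2 * S) _ _ (begin
    2 * (m * m + 2 * m + a) + 2 * S           ≡⟨ expand m a ⟩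
    2 * m * (2 * (suc m + 1)) + 1 + 2 * a + 1
      ≤⟨ +-monoˡ-≤ 1 (+-monoˡ-≤ (2 * a) (+-mono-≤ (*-monoʳ-≤ (2 * m) (*-monoʳ-≤ 2 (+-monoˡ-≤ 1 m<D))) h>0)) ⟩
    2 * m * (2 * (D + 1)) + h + 2 * a + 1     ≤⟨ +-monoˡ-≤ 1 chain ⟩
    2 * b + 2 * S + 1                         ≡⟨ collect b S ⟩
    suc (2 * b) + 2 * S                       ∎)
    where
    expand : ∀ m a → 2 * (m * m + 2 * m + a) + 2 * (m * suc m + suc m) ≡ 2 * m * (2 * (suc m + 1)) + 1 + 2 * a + 1
    expand = solve-∀
    collect : ∀ b S → 2 * b + 2 * S + 1 ≡ suc (2 * b) + 2 * S
    collect = solve-∀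

rn-middle-path : ∀ m → RadioNumberAtLeast (MP m) (m * m + 2 * m)
rn-middle-path zero D _ φ _ = inj₁ fzero , inj₁ fzero , z≤n
rn-middle-path (suc m) D (distances , _) φ radio =
  let u , v , u≢v , chain = enumeration-telescope φ level (2 * (D + 1)) gap
                               (order (suc m)) (order-unique (suc m)) (order-length (suc m)) z<s
  in v , u , span-arithmetic (suc m) D {φ u} {φ v} diameter-bound (level+level-positive u v u≢v)
                (subst (λ s → 2 * suc m * (2 * (D + 1)) + (level u + level v) + 2 * φ u ≤ 2 * φ v + 2 * s)
                       (sum-level-order (suc m)) chain)
  where
  gap : ∀ x y → x ≢ y → φ x ≤ φ y → 2 * (D + 1) + 2 * φ x ≤ 2 * φ y + (level x + level y)
  gap = radio-gap radio (λ x y → proj₁ (distances x y) , proj₁ (proj₂ (distances x y))) level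
          (λ x y → let w , W , 2w≤ = short-walk x y in w , W , ≤-trans 2w≤ (dist₂≤level+level x y))
  diameter-bound : suc (suc m) ≤ D
  diameter-bound =
    let d , (W , _) , d≤D = distances (inj₁ fzero) (inj₁ (fromℕ (suc m)))
    in ≤-trans (endpoints-far m W) d≤D

mainTheorem2 : (∀ (k : ℕ) → 1 ≤ k → RadioNumberAtLeast (Middle (Path (2 * k))) (4 * k * k ∸ 1))
    × (∀ (k : ℕ) → RadioNumberAtLeast (Middle (Path (2 * k + 1))) (4 * k * (k + 1)))
mainTheorem2 = even , odd
  where
  even : ∀ k → 1 ≤ k → RadioNumberAtLeast (Middle (Path (2 * k))) (4 * k * k ∸ 1)
  even (suc k) _ = subst₂ (λ n L → RadioNumberAtLeast (Middle (Path n)) L)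
                     (vertices k) (cong (_∸ 1) (bound k)) (rn-middle-path (suc (2 * k)))
    where
    vertices : ∀ k → suc (suc (2 * k)) ≡ 2 * suc k
    vertices = solve-∀
    bound : ∀ k → suc (suc (2 * k) * suc (2 * k) + 2 * suc (2 * k)) ≡ 4 * suc k * suc k
    bound = solve-∀
  odd : ∀ k → RadioNumberAtLeast (Middle (Path (2 * k + 1))) (4 * k * (k + 1))
  odd k = subst₂ (λ n L → RadioNumberAtLeast (Middle (Path n)) L)
            (vertices k) (bound k) (rn-middle-path (2 * k))
    where
    vertices : ∀ k → suc (2 * k) ≡ 2 * k + 1
    vertices = solve-∀
    bound : ∀ k → 2 * k * (2 * k) + 2 * (2 * k) ≡ 4 * k * (k + 1)
    bound = solve-∀
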